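{- Let $N=(P,T,W)$ be a unit-weighted Petri net (all arc weights in $\{0,1\}$) and let $S=(N,M_0)$ be a system such that $M_0=k\cdot M_0'$ for some positive integer $k$ and some marking $M_0'$. If some (non-empty) siphon $D$ of $N$ is deadlocked at some marking $M'$ reachable in $S'=(N,M_0')$, then $k\cdot M'$ is reachable in $S$ and $D$ is deadlocked at $k\cdot M'$.
   Context: A Petri net is $N=(P,T,W)$ with finite disjoint sets $P$ (places) and $T$ (transitions) and $W:(P\times T)\cup(T\times P)\to\mathbb{N}$. For a node $n$, ${}^\bullet n=\{n' : W(n',n)>0\}$ and $n^\bullet=\{n' : W(n,n')>0\}$; for a set $A$ of nodes, ${}^\bullet A=\bigcup_{n\in A}{}^\bullet n$ and $A^\bullet=\bigcup_{n\in A}n^\bullet$. A marking is $M\in\mathbb{N}^P$; a system is a pair $(N,M_0)$. A transition $t$ is enabled at $M$ if $M(p)\ge W(p,t)$ for all $p\in{}^\bullet t$; firing it yields $M'$ with $M'(p)=M(p)-W(p,t)+W(t,p)$. A marking is reachable if obtained from $M_0$ by a finite sequence of such firings. A siphon is a non-empty set $D\subseteq P$ with ${}^\bullet D\subseteq D^\bullet$. A siphon $D$ is deadlocked at a marking $M$ if for each $p\in D$ and each $t\in p^\bullet$, $M(p)<W(p,t)$. -}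

module Defs where

open import Data.Nat using (ℕ; _≤_; _<_; _*_; _+_; _∸_; zero; suc)
open import Data.Fin using (Fin)
open import Data.Fin.Subset using (Subset; _∈_; Nonempty)
open import Data.Product using (Σ; ∃; _×_; _,_)
open import Data.List using (List; []; _∷_)
open import Relation.Binary.PropositionalEquality using (_≡_)

-- A Petri net with places Fin np and transitions Fin nt.
-- W(p,t) is `pre p t`, W(t,p) is `post t p`.
record PetriNet (np nt : ℕ) : Set where
  field
    pre  : Fin np → Fin nt → ℕ
    post : Fin nt → Fin np → ℕ
open PetriNet public

Marking : ℕ → Set
Marking np = Fin np → ℕ

UnitWeighted : ∀ {np nt} → PetriNet np nt → Set
UnitWeighted N = (∀ p t → pre N p t ≤ 1) × (∀ t p → post N t p ≤ 1)

_·_ : ∀ {np} → ℕ → Marking np → Marking np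
(k · M) p = k * M p

-- t enabled at M: M(p) ≥ W(p,t) for all p in •t (equivalently for all p,
-- since W(p,t) = 0 otherwise)
Enabled : ∀ {np nt} → PetriNet np nt → Marking np → Fin nt → Set
Enabled N M t = ∀ p → 0 < pre N p t → pre N p t ≤ M p

Fires : ∀ {np nt} → PetriNet np nt → Marking np → Fin nt → Marking np → Set
Fires N M t M' = Enabled N M t × (∀ p → M' p ≡ (M p ∸ pre N p t) + post N t p)

-- reachability: finite firing sequences from M0.  Markings are functions,
-- so the empty sequence reaches any marking pointwise equal to M0
-- (avoids needing function extensionality).
data Reachable {np nt} (N : PetriNet np nt) (M0 : Marking np) : Marking np → Set where
  here : ∀ {M} → (∀ p → M p ≡ M0 p) → Reachable N M0 M
  step : ∀ {M M'} t → Reachable N M0 M → Fires N M t M' → Reachable N M0 M'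

IsSiphon : ∀ {np nt} → PetriNet np nt → Subset np → Set
IsSiphon {np} N D =
  Nonempty D ×
  (∀ t p → p ∈ D → 0 < post N t p → ∃ λ (p' : Fin np) → p' ∈ D × 0 < pre N p' t)

DeadlockedAt : ∀ {np nt} → PetriNet np nt → Subset np → Marking np → Set
DeadlockedAt N D M = ∀ p t → p ∈ D → 0 < pre N p t → M p < pre N p t

module Submission where

-- If M [t⟩ M', then from k·M the transition t can be fired
-- k times in a row, ending in k·M'.  The intermediate markings are the
-- combinations a·M' + b·M with a + b = k: since b ≥ 1, the summand b·M
-- alone covers the tokens t consumes, and one firing turns a·M' + (b+1)·M
-- into (a+1)·M' + b·M (lemma `fire-combination`).  Iterating this
-- (`replay-firing`) shows that reachability of k·M implies reachability of
-- k·M'; induction on a firing sequence of (N, M0') then yields that k·X is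
-- reachable in (N, k·M0') for every X reachable in (N, M0') (`scale-run`).
--
-- With arc weights at most 1, a place p of a deadlocked set D
-- with an output transition t satisfies M(p) < W(p,t) ≤ 1, so M(p) = 0;
-- hence k·M(p) = 0 as well and the siphon stays deadlocked at k·M.
--
-- Neither part needs k ≠ 0 or the siphon property; the theorem follows by
-- combining the two.

open import Defs
open import Data.Nat using (ℕ; NonZero; zero; suc; _+_; _*_; _∸_; _≤_; _<_; z≤n; s≤s)
open import Data.Nat.Properties
  using (≤-trans; m≤m+n; m≤n+m; +-assoc; +-comm; +-identityʳ; +-suc; +-∸-assoc; *-zeroʳ; n<1⇒n≡0)
open import Data.Fin.Subset using (Subset; _∈_)
open import Data.Product using (_×_; _,_)
open import Relation.Binary.PropositionalEquality using (_≡_; refl; sym; subst; trans; cong; module ≡-Reasoning)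

combination : ∀ {np} → ℕ → Marking np → ℕ → Marking np → Marking np
combination a M' b M p = a * M' p + b * M p

combination-update : ∀ a b m m' q r → q ≤ m → m' ≡ (m ∸ q) + r →
                     (a * m' + suc b * m ∸ q) + r ≡ suc a * m' + b * m
combination-update a b m m' q r q≤m m'≡ = begin
  (a * m' + (m + b * m) ∸ q) + r    ≡⟨ cong (λ z → (z ∸ q) + r) (regroup (a * m') m (b * m)) ⟩
  ((a * m' + b * m) + m ∸ q) + r    ≡⟨ cong (_+ r) (+-∸-assoc (a * m' + b * m) q≤m) ⟩
  ((a * m' + b * m) + (m ∸ q)) + r  ≡⟨ +-assoc (a * m' + b * m) (m ∸ q) r ⟩
  (a * m' + b * m) + ((m ∸ q) + r)  ≡⟨ cong ((a * m' + b * m) +_) (sym m'≡) ⟩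
  (a * m' + b * m) + m'             ≡⟨ +-comm (a * m' + b * m) m' ⟩
  m' + (a * m' + b * m)             ≡⟨ sym (+-assoc m' (a * m') (b * m)) ⟩
  suc a * m' + b * m                ∎
  where
  open ≡-Reasoning
  regroup : ∀ x y z → x + (y + z) ≡ (x + z) + y
  regroup x y z = trans (cong (x +_) (+-comm y z)) (sym (+-assoc x z y))

deadlocked-place-empty : ∀ {np nt} (N : PetriNet np nt) → (∀ p t → pre N p t ≤ 1) →
                         ∀ {D M} → DeadlockedAt N D M →
                         ∀ p t → p ∈ D → 0 < pre N p t → M p ≡ 0
deadlocked-place-empty N unit dead p t p∈D out =
  n<1⇒n≡0 (≤-trans (dead p t p∈D out) (unit p t))

deadlocked-scale : ∀ {np nt} (N : PetriNet np nt) → (∀ p t → pre N p t ≤ 1) →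
                   ∀ {D M} k → DeadlockedAt N D M → DeadlockedAt N D (k · M)
deadlocked-scale N unit k dead p t p∈D out
  rewrite deadlocked-place-empty N unit dead p t p∈D out | *-zeroʳ k = out

module _ {np nt} (N : PetriNet np nt) where

  -- Reachable markings are closed under pointwise equality (markings are
  -- functions, so this replaces function extensionality).
  reachable-resp : ∀ {M0 X Y} → Reachable N M0 X → (∀ p → Y p ≡ X p) → Reachable N M0 Y
  reachable-resp (here X≡M0)             Y≡X = here (λ p → trans (Y≡X p) (X≡M0 p))
  reachable-resp (step t r (en , X≡))    Y≡X = step t r (en , λ p → trans (Y≡X p) (X≡ p))

  enabled⇒pre≤ : ∀ {M t} → Enabled N M t → ∀ p → pre N p t ≤ M p
  enabled⇒pre≤ {M} {t} en p with pre N p t in eq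
  ... | zero  = z≤n
  ... | suc w = subst (_≤ M p) eq (en p (subst (0 <_) (sym eq) (s≤s z≤n)))

  fire-combination : ∀ {M M' t} → Fires N M t M' → ∀ a b →
                     Fires N (combination a M' (suc b) M) t (combination (suc a) M' b M)
  fire-combination {M} {M'} {t} (en , M'≡) a b = enabled , λ p →
      sym (combination-update a b (M p) (M' p) (pre N p t) (post N t p) (pre≤ p) (M'≡ p))
    where
    pre≤ : ∀ p → pre N p t ≤ M p
    pre≤ = enabled⇒pre≤ en
    enabled : Enabled N (combination a M' (suc b) M) t
    enabled p _ = ≤-trans (≤-trans (pre≤ p) (m≤m+n (M p) (b * M p))) (m≤n+m _ (a * M' p))

  replay-firing : ∀ {M0 M M' t} → Fires N M t M' → ∀ a b →
                  Reachable N M0 (combination a M' b M) → Reachable N M0 ((a + b) · M')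
  replay-firing {M' = M'} f a zero r =
    reachable-resp r (λ p → trans (cong (_* M' p) (+-identityʳ a)) (sym (+-identityʳ _)))
  replay-firing {M' = M'} {t} f a (suc b) r =
    reachable-resp (replay-firing f (suc a) b (step t r (fire-combination f a b)))
                   (λ p → cong (_* M' p) (+-suc a b))

  scale-firing : ∀ {M0 M M' t} → Fires N M t M' → ∀ k →
                 Reachable N M0 (k · M) → Reachable N M0 (k · M')
  scale-firing f k r =
    replay-firing f 0 k (reachable-resp r (λ p → refl))

  scale-run : ∀ {M0 M0' X} k → (∀ p → M0 p ≡ (k · M0') p) →
              Reachable N M0' X → Reachable N M0 (k · X)
  scale-run k M0≡ (here X≡M0')  = here (λ p → trans (cong (k *_) (X≡M0' p)) (sym (M0≡ p)))
  scale-run k M0≡ (step t r f)  = scale-firing f k (scale-run k M0≡ r)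

mainTheorem1 : ∀ {np nt} (N : PetriNet np nt) → UnitWeighted N →
    (k : ℕ) → NonZero k → (M0 M0' : Marking np) → (∀ p → M0 p ≡ (k · M0') p) →
    (D : Subset np) → IsSiphon N D →
    (M' : Marking np) → Reachable N M0' M' → DeadlockedAt N D M' →
    Reachable N M0 (k · M') × DeadlockedAt N D (k · M')
mainTheorem1 N (unit-pre , _) k _ M0 M0' M0≡ D _ M' reach dead =
  scale-run N k M0≡ reach , deadlocked-scale N unit-pre k dead
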